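{- Let $d\ge2$, let $A\subseteq\mathbb{N}$ be $d$-automatic, and let $L=\{\sigma\in\Sigma^*:[\sigma]\in A\}$. The following are equivalent: (1) $A$ is generic in $\mathbb{N}$; (2) for all $r,s\in\mathbb{N}$ with $s\ge1$, every $\tau\in\Sigma^*$ occurs as a suffix of some word in $L$ of length $r+sk$ for some $k\ge0$.
   Context: $\mathbb{N}=\{0,1,\ldots\}$, $\Sigma=\{0,\ldots,d-1\}$, $\Sigma_\pm=\{ -d+1,\ldots,d-1\}$. For a string $k_0\cdots k_n$ of integers, $[k_0\cdots k_n]=\sum_ik_id^i$ (least significant digit first). $A\subseteq\mathbb{Z}$ is $d$-automatic if $\{\sigma\in\Sigma_\pm^*:[\sigma]\in A\}$ is regular. $A\subseteq\mathbb{N}$ is generic in $\mathbb{N}$ if some finite union of translates $c+A$ ($c\in\mathbb{Z}$, possibly negative) covers $\mathbb{N}$. -}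

module Defs where

open import Data.Nat using (ℕ; _+_; _*_; _∸_; _≤_)
open import Data.Integer as ℤ using (ℤ; +_)
open import Data.Fin using (Fin; toℕ)
open import Data.List using (List; []; _∷_; _++_; length)
open import Data.Bool using (Bool; true)
open import Data.Product using (Σ; ∃; ∃-syntax; _×_)
open import Data.List.Membership.Propositional using (_∈_)
open import Relation.Binary.PropositionalEquality using (_≡_)
open import Function.Bundles using (_⇔_)

record DFA (n : ℕ) : Set where
  field
    states    : ℕ
    start     : Fin states
    δ         : Fin states → Fin n → Fin states
    accepting : Fin states → Bool

  run : Fin states → List (Fin n) → Fin states
  run q []       = q
  run q (a ∷ w)  = run (δ q a) w

  accepts : List (Fin n) → Bool
  accepts w = accepting (run start w)

Regular : (n : ℕ) → (List (Fin n) → Set) → Set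
Regular n L = Σ (DFA n) λ M → ∀ w → (DFA.accepts M w ≡ true) ⇔ L w

-- Signed digits Σ± = {-d+1,…,d-1}, encoded as Fin (d + (d ∸ 1)) (2d-1 letters);
-- the letter i denotes the integer i - (d-1).
SDigit : ℕ → Set
SDigit d = Fin (d + (d ∸ 1))

sdigitVal : (d : ℕ) → SDigit d → ℤ
sdigitVal d i = (+ toℕ i) ℤ.- (+ (d ∸ 1))

-- [k0 ... kn] = Σ k_i d^i, least significant digit first.
evalℤ : (d : ℕ) → List (SDigit d) → ℤ
evalℤ d []       = + 0
evalℤ d (k ∷ ks) = sdigitVal d k ℤ.+ (+ d) ℤ.* evalℤ d ks

evalℕ : (d : ℕ) → List (Fin d) → ℕ
evalℕ d []       = 0
evalℕ d (k ∷ ks) = toℕ k + d * evalℕ d ks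

AutomaticℤSet : (d : ℕ) → (ℤ → Set) → Set
AutomaticℤSet d A = Regular (d + (d ∸ 1)) (λ σ → A (evalℤ d σ))

asℤSet : (ℕ → Set) → ℤ → Set
asℤSet A z = ∃[ m ] (z ≡ + m × A m)

Generic : (ℕ → Set) → Set
Generic A = Σ (List ℤ) λ cs →
  ∀ (n : ℕ) → ∃[ c ] (c ∈ cs × ∃[ m ] (A m × (+ n) ≡ c ℤ.+ (+ m)))

Suffix : {X : Set} → List X → List X → Set
Suffix {X} τ σ = ∃[ ρ ] (σ ≡ ρ ++ τ)

-- Condition (2), with L = {σ ∈ Σ* : [σ] ∈ A}.
Cond2 : (d : ℕ) → (ℕ → Set) → Set
Cond2 d A = ∀ (r s : ℕ) → 1 ≤ s → ∀ (τ : List (Fin d)) →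
  ∃[ k ] ∃[ σ ] (A (evalℕ d σ) × length σ ≡ r + s * k × Suffix τ σ)

module Submission where

-- Both conditions are compared with two
-- intermediate notions: A has gaps at most C (every interval [n, n + C]
-- meets A), and A is m-completable (every τ ∈ Σ* is a suffix of a word of
-- L whose remaining prefix has exactly m letters).
--
-- (1) ⇒ (2)  Generic sets have bounded gaps.  If the gaps are at most
--   C < d^m, A is m-completable: an element of A lies just above d^m·[τ],
--   and its offset is written with m digits.  Choosing m ≥ C with
--   m + |τ| ≡ r (mod s) gives (2).  Automaticity is not used here.
-- (2) ⇒ (1)  L is recognised by a DFA over Σ (the signed-digit automaton
--   restricted to nonnegative digits).  The sets of states reachable by
--   words of length m are eventually periodic in m (pigeonhole on subsets),
--   say R(a + p·k) ⊆ R(a).  Applying (2) with r = a + |τ|, s = p and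
--   replacing the prefix by one of length a reaching the same state shows A
--   is a-completable.  Hence every block [D·t, D·t + D), D = d^a, meets A,
--   so A has gaps at most 2D, and bounded gaps give genericity.

open import Defs
open import Data.Nat using (ℕ; _≤_)
open import Function.Bundles using (_⇔_)

open import Level using (0ℓ)
open import Data.Nat using (zero; suc; _+_; _*_; _∸_; _^_; _<_; NonZero; >-nonZero; z≤n; s≤s)
open import Data.Nat.Properties
open import Data.Nat.DivMod using (_/_; _%_; m≡m%n+[m/n]*n; m%n<n; m/n*n≤m; m<n*o⇒m/o<n)
open import Data.Nat.Tactic.RingSolver using (solve-∀)
open import Data.Integer as ℤ using (+_; -[1+_]; _⊖_)
import Data.Integer.Properties as ℤP
open import Data.Fin using (Fin; toℕ; fromℕ<; funToFin; finToFun)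
import Data.Fin as Fin
open import Data.Fin.Properties using (toℕ<n; toℕ-fromℕ<; pigeonhole; any?; finToFun-funToFin)
import Data.Fin.Properties as Finₚ
open import Data.List using (List; []; _∷_; _++_; length; map; upTo)
open import Data.List.Properties using (length-++)
open import Data.List.Extrema.Nat using (max; xs≤max)
open import Data.List.Membership.Propositional using (_∈_)
open import Data.List.Membership.Propositional.Properties using (∈-map⁺; ∈-upTo⁺)
import Data.List.Relation.Unary.All as All
open import Data.Bool using (true)
open import Data.Product using (∃-syntax; _×_; _,_)
open import Data.Empty using (⊥-elim)
open import Relation.Nullary using (Dec; yes; no)
open import Relation.Nullary.Decidable using (map′)
open import Relation.Unary using (Decidable)
open import Relation.Binary.PropositionalEquality
open import Function.Bundles using (Equivalence; mk⇔)
open import Function.Properties.Equivalence using (⇔-setoid)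
import Relation.Binary.Reasoning.Setoid as SetoidReasoning

evalℕ-++ : ∀ d (u v : List (Fin d)) →
  evalℕ d (u ++ v) ≡ evalℕ d u + d ^ length u * evalℕ d v
evalℕ-++ d []      v = sym (+-identityʳ (evalℕ d v))
evalℕ-++ d (k ∷ u) v = begin
  toℕ k + d * evalℕ d (u ++ v)
    ≡⟨ cong (λ x → toℕ k + d * x) (evalℕ-++ d u v) ⟩
  toℕ k + d * (evalℕ d u + d ^ length u * evalℕ d v)
    ≡⟨ regroup (toℕ k) d (evalℕ d u) (d ^ length u) (evalℕ d v) ⟩
  toℕ k + d * evalℕ d u + d * d ^ length u * evalℕ d v ∎
  where
  open ≡-Reasoning
  regroup : ∀ a b c x y → a + b * (c + x * y) ≡ a + b * c + b * x * y
  regroup = solve-∀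

evalℕ-prefix : ∀ d (ρ τ : List (Fin d)) {m x} → length ρ ≡ m → evalℕ d ρ ≡ x →
  evalℕ d (ρ ++ τ) ≡ x + d ^ m * evalℕ d τ
evalℕ-prefix d ρ τ refl refl = evalℕ-++ d ρ τ

evalℕ-< : ∀ d (w : List (Fin d)) → evalℕ d w < d ^ length w
evalℕ-< d []      = s≤s z≤n
evalℕ-< d (k ∷ w) = begin-strict
  toℕ k + d * evalℕ d w  <⟨ +-monoˡ-< (d * evalℕ d w) (toℕ<n k) ⟩
  d + d * evalℕ d w      ≡⟨ sym (*-suc d (evalℕ d w)) ⟩
  d * suc (evalℕ d w)    ≤⟨ *-monoʳ-≤ d (evalℕ-< d w) ⟩
  d * d ^ length w       ∎
  where open ≤-Reasoning

numeral : ∀ d .{{_ : NonZero d}} m x → x < d ^ m →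
  ∃[ w ] (length w ≡ m × evalℕ d w ≡ x)
numeral d zero    zero    _        = [] , refl , refl
numeral d zero    (suc x) (s≤s ())
numeral d (suc m) x       x<d^1+m  =
  let w , len , val = numeral d m (x / d) x/d<d^m
  in fromℕ< (m%n<n x d) ∷ w , cong suc len , (begin
    toℕ (fromℕ< (m%n<n x d)) + d * evalℕ d w
      ≡⟨ cong₂ (λ r q → r + d * q) (toℕ-fromℕ< (m%n<n x d)) val ⟩
    x % d + d * (x / d)  ≡⟨ cong (λ y → x % d + y) (*-comm d (x / d)) ⟩
    x % d + x / d * d    ≡⟨ sym (m≡m%n+[m/n]*n x d) ⟩
    x                    ∎)
  where
  open ≡-Reasoning
  x/d<d^m : x / d < d ^ m
  x/d<d^m = m<n*o⇒m/o<n (subst (x <_) (*-comm d (d ^ m)) x<d^1+m)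

n<d^n : ∀ d → 1 < d → ∀ n → n < d ^ n
n<d^n d 1<d zero    = s≤s z≤n
n<d^n d 1<d (suc n) = ≤-<-trans (n<d^n d 1<d n) (^-monoʳ-< d 1<d (n<1+n n))

m+k⊖k≡m : ∀ m k → m + k ⊖ k ≡ + m
m+k⊖k≡m m k = trans (ℤP.⊖-≥ (m≤n+m k m)) (cong +_ (m+n∸n≡m m k))

toSigned : ∀ d → Fin d → SDigit d
toSigned d i = fromℕ< (+-monoˡ-< (d ∸ 1) (toℕ<n i))

sdigitVal-toSigned : ∀ d i → sdigitVal d (toSigned d i) ≡ + toℕ i
sdigitVal-toSigned d i = begin
  + toℕ (toSigned d i) ℤ.- + (d ∸ 1)
    ≡⟨ cong (λ x → + x ℤ.- + (d ∸ 1)) (toℕ-fromℕ< (+-monoˡ-< (d ∸ 1) (toℕ<n i))) ⟩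
  + (toℕ i + (d ∸ 1)) ℤ.- + (d ∸ 1)  ≡⟨ ℤP.[+m]-[+n]≡m⊖n (toℕ i + (d ∸ 1)) (d ∸ 1) ⟩
  toℕ i + (d ∸ 1) ⊖ (d ∸ 1)          ≡⟨ m+k⊖k≡m (toℕ i) (d ∸ 1) ⟩
  + toℕ i                            ∎
  where open ≡-Reasoning

evalℤ-toSigned : ∀ d w → evalℤ d (map (toSigned d) w) ≡ + evalℕ d w
evalℤ-toSigned d []      = refl
evalℤ-toSigned d (k ∷ w) = begin
  sdigitVal d (toSigned d k) ℤ.+ + d ℤ.* evalℤ d (map (toSigned d) w)
    ≡⟨ cong₂ (λ x y → x ℤ.+ + d ℤ.* y) (sdigitVal-toSigned d k) (evalℤ-toSigned d w) ⟩
  + toℕ k ℤ.+ + d ℤ.* + evalℕ d w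
    ≡⟨ cong (λ y → + toℕ k ℤ.+ y) (sym (ℤP.pos-* d (evalℕ d w))) ⟩
  + (toℕ k + d * evalℕ d w) ∎
  where open ≡-Reasoning

restrict : ∀ {m n} → (Fin m → Fin n) → DFA n → DFA m
restrict ℓ M = record
  { states    = DFA.states M
  ; start     = DFA.start M
  ; δ         = λ q a → DFA.δ M q (ℓ a)
  ; accepting = DFA.accepting M
  }

run-restrict : ∀ {m n} (ℓ : Fin m → Fin n) (M : DFA n) q w →
  DFA.run (restrict ℓ M) q w ≡ DFA.run M q (map ℓ w)
run-restrict ℓ M q []      = refl
run-restrict ℓ M q (a ∷ w) = run-restrict ℓ M (DFA.δ M q (ℓ a)) w

asℤSet-+ : ∀ (A : ℕ → Set) x → asℤSet A (+ x) ⇔ A x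
asℤSet-+ A x = mk⇔ (λ (m , x≡m , Am) → subst A (sym (ℤP.+-injective x≡m)) Am)
                   (λ Ax → x , refl , Ax)

digitLanguageRegular : ∀ d (A : ℕ → Set) → AutomaticℤSet d (asℤSet A) →
  Regular d (λ w → A (evalℕ d w))
digitLanguageRegular d A (M , M-recognises) = restrict (toSigned d) M , λ w → begin
  (DFA.accepts (restrict (toSigned d) M) w ≡ true)
    ≡⟨ cong (λ q → DFA.accepting M q ≡ true) (run-restrict (toSigned d) M (DFA.start M) w) ⟩
  (DFA.accepts M (map (toSigned d) w) ≡ true)  ≈⟨ M-recognises (map (toSigned d) w) ⟩
  asℤSet A (evalℤ d (map (toSigned d) w))       ≡⟨ cong (asℤSet A) (evalℤ-toSigned d w) ⟩
  asℤSet A (+ evalℕ d w)                        ≈⟨ asℤSet-+ A (evalℕ d w) ⟩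
  A (evalℕ d w)                                 ∎
  where open SetoidReasoning (⇔-setoid 0ℓ)

bit : ∀ {P : Set} → Dec P → Fin 2
bit (yes _) = Fin.suc Fin.zero
bit (no _)  = Fin.zero

bit-transport : ∀ {P Q : Set} (P? : Dec P) (Q? : Dec Q) → bit P? ≡ bit Q? → P → Q
bit-transport _       (yes q) _  _ = q
bit-transport (no ¬p) (no _)  _  p = ⊥-elim (¬p p)
bit-transport (yes _) (no _)  ()

encode : ∀ {S} {P : Fin S → Set} → Decidable P → Fin (2 ^ S)
encode P? = funToFin (λ q → bit (P? q))

encode-injective : ∀ {S} {P Q : Fin S → Set} (P? : Decidable P) (Q? : Decidable Q) →
  encode P? ≡ encode Q? → ∀ q → P q → Q q
encode-injective P? Q? same q = bit-transport (P? q) (Q? q) (begin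
  bit (P? q)                ≡⟨ sym (finToFun-funToFin (λ q → bit (P? q)) q) ⟩
  finToFun (encode P?) q    ≡⟨ cong (λ c → finToFun c q) same ⟩
  finToFun (encode Q?) q    ≡⟨ finToFun-funToFin (λ q → bit (Q? q)) q ⟩
  bit (Q? q)                ∎)
  where open ≡-Reasoning

-- Pigeonhole for subsets: among the first 2^S + 1 members of a sequence of
-- decidable subsets of Fin S, two coincide; we record one inclusion.
repeatedSubset : ∀ {S} (P : ℕ → Fin S → Set) → (∀ m → Decidable (P m)) →
  ∃[ i ] ∃[ j ] (i < j × ∀ q → P j q → P i q)
repeatedSubset {S} P P? =
  let i , j , i<j , same = pigeonhole (n<1+n (2 ^ S)) (λ m → encode (P? (toℕ m)))
  in toℕ i , toℕ j , i<j , encode-injective (P? (toℕ j)) (P? (toℕ i)) (sym same)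

module Reachability {n : ℕ} (M : DFA n) where
  open DFA M

  run-++ : ∀ q u v → run q (u ++ v) ≡ run (run q u) v
  run-++ q []      v = refl
  run-++ q (a ∷ u) v = run-++ (δ q a) u v

  accepts-prefix : ∀ ρ ρ' τ → run start ρ ≡ run start ρ' →
    accepts (ρ ++ τ) ≡ accepts (ρ' ++ τ)
  accepts-prefix ρ ρ' τ same = begin
    accepting (run start (ρ ++ τ))    ≡⟨ cong accepting (run-++ start ρ τ) ⟩
    accepting (run (run start ρ) τ)   ≡⟨ cong (λ q → accepting (run q τ)) same ⟩
    accepting (run (run start ρ') τ)  ≡⟨ cong accepting (sym (run-++ start ρ' τ)) ⟩
    accepting (run start (ρ' ++ τ))   ∎
    where open ≡-Reasoning

  Reach : ℕ → Fin states → Fin states → Set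
  Reach m q q' = ∃[ w ] (length w ≡ m × run q w ≡ q')

  reach? : ∀ m q q' → Dec (Reach m q q')
  reach? zero    q q' = map′ (λ q≡q' → [] , refl , q≡q')
                             (λ { ([] , _ , q≡q') → q≡q' ; (_ ∷ _ , () , _) })
                             (q Finₚ.≟ q')
  reach? (suc m) q q' = map′ (λ (a , w , len , r) → a ∷ w , cong suc len , r)
                             (λ { (a ∷ w , len , r) → a , w , suc-injective len , r
                                ; ([] , () , _) })
                             (any? λ a → reach? m (δ q a) q')

  split : ∀ m {k q q''} → Reach (m + k) q q'' → ∃[ q' ] (Reach m q q' × Reach k q' q'')
  split zero    {q = q} r = q , ([] , refl , refl) , r
  split (suc m) ([] , () , _)
  split (suc m) (a ∷ w , len , r) =
    let q' , (u , lu , ru) , rest = split m (w , suc-injective len , r)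
    in q' , (a ∷ u , cong suc lu , ru) , rest

  join : ∀ {m k q q' q''} → Reach m q q' → Reach k q' q'' → Reach (m + k) q q''
  join {q = q} (u , lu , ru) (v , lv , rv) =
    u ++ v , trans (length-++ u) (cong₂ _+_ lu lv) ,
    trans (run-++ q u v) (trans (cong (λ s → run s v) ru) rv)

  Reachable : ℕ → Fin states → Set
  Reachable m = Reach m start

  reachable-+ : ∀ {m m'} k → (∀ q → Reachable m q → Reachable m' q) →
    ∀ q → Reachable (m + k) q → Reachable (m' + k) q
  reachable-+ {m} k m⊆m' q r =
    let q' , r₁ , r₂ = split m r in join (m⊆m' q' r₁) r₂

  eventuallyPeriodic : ∃[ a ] ∃[ p ] (1 ≤ p × ∀ k q → Reachable (a + p * k) q → Reachable a q)
  eventuallyPeriodic =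
    let i , j , i<j , j⊆i = repeatedSubset Reachable (λ m → reach? m start)
    in i , j ∸ i , m<n⇒0<n∸m i<j , periodic i<j j⊆i
    where
    periodic : ∀ {i j} → i < j → (∀ q → Reachable j q → Reachable i q) →
      ∀ k q → Reachable (i + (j ∸ i) * k) q → Reachable i q
    periodic {i} {j} i<j j⊆i zero q =
      subst (λ m → Reachable m q) (trans (cong (λ y → i + y) (*-zeroʳ (j ∸ i))) (+-identityʳ i))
    periodic {i} {j} i<j j⊆i (suc k) q r =
      j⊆i q (subst (λ m → Reachable m q) (m+[n∸m]≡n (<⇒≤ i<j))
               (reachable-+ (j ∸ i) (periodic i<j j⊆i k) q
                 (subst (λ m → Reachable m q) (unfold i (j ∸ i) k) r)))
      where
      unfold : ∀ a p k → a + p * suc k ≡ (a + p * k) + p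
      unfold = solve-∀

BoundedGaps : (ℕ → Set) → ℕ → Set
BoundedGaps A C = ∀ n → ∃[ m ] (A m × n ≤ m × m ≤ n + C)

translate-bound : ∀ {n m C} c → ℤ.∣ c ∣ ≤ C → + (n + C) ≡ c ℤ.+ + m →
  n ≤ m × m ≤ n + (C + C)
translate-bound {n} {m} {C} (+ a) a≤C eq = n≤m , m≤n+2C
  where
  open ≤-Reasoning
  n+C≡a+m : n + C ≡ a + m
  n+C≡a+m = ℤP.+-injective eq
  n≤m : n ≤ m
  n≤m = +-cancelʳ-≤ C n m (begin
    n + C  ≡⟨ n+C≡a+m ⟩
    a + m  ≤⟨ +-monoˡ-≤ m a≤C ⟩
    C + m  ≡⟨ +-comm C m ⟩
    m + C  ∎)
  m≤n+2C : m ≤ n + (C + C)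
  m≤n+2C = begin
    m            ≤⟨ m≤n+m m a ⟩
    a + m        ≡⟨ sym n+C≡a+m ⟩
    n + C        ≤⟨ m≤m+n (n + C) C ⟩
    n + C + C    ≡⟨ +-assoc n C C ⟩
    n + (C + C)  ∎
translate-bound {n} {m} {C} -[1+ b ] 1+b≤C eq = n≤m , m≤n+2C
  where
  open ≤-Reasoning
  m≡n+C+1+b : m ≡ n + C + suc b
  m≡n+C+1+b = sym (ℤP.+-injective (trans (cong (ℤ._+ + suc b) eq)
    (trans (ℤP.distribˡ-⊖-+-pos (suc b) m (suc b)) (m+k⊖k≡m m (suc b)))))
  n≤m : n ≤ m
  n≤m = begin
    n              ≤⟨ m≤m+n n C ⟩
    n + C          ≤⟨ m≤m+n (n + C) (suc b) ⟩
    n + C + suc b  ≡⟨ sym m≡n+C+1+b ⟩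
    m              ∎
  m≤n+2C : m ≤ n + (C + C)
  m≤n+2C = begin
    m              ≡⟨ m≡n+C+1+b ⟩
    n + C + suc b  ≤⟨ +-monoʳ-≤ (n + C) 1+b≤C ⟩
    n + C + C      ≡⟨ +-assoc n C C ⟩
    n + (C + C)    ∎

-- A generic set has bounded gaps: if every |c| ≤ C, then the translate
-- covering n + C places an element of A in [n, n + 2C].
generic⇒boundedGaps : ∀ {A} → Generic A → ∃[ C ] BoundedGaps A C
generic⇒boundedGaps {A} (cs , covers) = C + C , gaps
  where
  C : ℕ
  C = max 0 (map ℤ.∣_∣ cs)
  gaps : BoundedGaps A (C + C)
  gaps n =
    let c , c∈cs , m , Am , eq = covers (n + C)
        ∣c∣≤C = All.lookup (xs≤max 0 (map ℤ.∣_∣ cs)) (∈-map⁺ ℤ.∣_∣ c∈cs)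
    in m , Am , translate-bound c ∣c∣≤C eq

-- Conversely, gaps at most C make A generic, via the translates -j, j ≤ C.
boundedGaps⇒generic : ∀ {A C} → BoundedGaps A C → Generic A
boundedGaps⇒generic {A} {C} gaps = map (λ j → ℤ.- + j) (upTo (suc C)) , cover
  where
  cover : ∀ n → ∃[ c ] (c ∈ map (λ j → ℤ.- + j) (upTo (suc C)) × ∃[ m ] (A m × + n ≡ c ℤ.+ + m))
  cover n =
    let m , Am , n≤m , m≤n+C = gaps n
    in ℤ.- + (m ∸ n) ,
       ∈-map⁺ (λ j → ℤ.- + j) (∈-upTo⁺ (s≤s (m≤n+o⇒m∸n≤o m n m≤n+C))) ,
       m , Am ,
       sym (trans (ℤP.-m+n≡n⊖m (m ∸ n) m)
             (trans (ℤP.⊖-≥ (m∸n≤m m n)) (cong +_ (m∸[m∸n]≡n n≤m))))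

Completable : (d : ℕ) → (ℕ → Set) → ℕ → Set
Completable d A m = ∀ (τ : List (Fin d)) → ∃[ ρ ] (length ρ ≡ m × A (evalℕ d (ρ ++ τ)))

-- Gaps at most C < d^m: some element of A lies in [d^m·[τ], d^m·[τ] + C],
-- and its offset from d^m·[τ] is an m-digit numeral.
boundedGaps⇒completable : ∀ d .{{_ : NonZero d}} {A C m} →
  BoundedGaps A C → C < d ^ m → Completable d A m
boundedGaps⇒completable d {A} {C} {m} gaps C<d^m τ =
  let base = d ^ m * evalℕ d τ
      a , Aa , base≤a , a≤base+C = gaps base
      offset<d^m = ≤-<-trans (m≤n+o⇒m∸n≤o a base a≤base+C) C<d^m
      ρ , len , val = numeral d m (a ∸ base) offset<d^m
  in ρ , len , subst A (sym (trans (evalℕ-prefix d ρ τ len val) (m∸n+n≡m base≤a))) Aa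

-- Condition (2) from bounded gaps: with k = |τ| + C the prefix length
-- m = r + s·k - |τ| is at least C, so C < d^m.
boundedGaps⇒cond2 : ∀ d .{{_ : NonZero d}} → 1 < d → ∀ {A C} → BoundedGaps A C → Cond2 d A
boundedGaps⇒cond2 d 1<d {A} {C} gaps r s 1≤s τ =
  let ρ , len , Aρτ = boundedGaps⇒completable d gaps C<d^m τ
  in k , ρ ++ τ , Aρτ , trans (length-++ ρ) (trans (cong (_+ length τ) len) (m∸n+n≡m |τ|≤N)) ,
     ρ , refl
  where
  k N m : ℕ
  k = length τ + C
  N = r + s * k
  m = N ∸ length τ
  k≤N : k ≤ N
  k≤N = ≤-trans (m≤n*m k s {{>-nonZero 1≤s}}) (m≤n+m (s * k) r)
  |τ|≤N : length τ ≤ N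
  |τ|≤N = ≤-trans (m≤m+n (length τ) C) k≤N
  C≤m : C ≤ m
  C≤m = subst (_≤ m) (m+n∸m≡n (length τ) C) (∸-monoˡ-≤ (length τ) k≤N)
  C<d^m : C < d ^ m
  C<d^m = <-≤-trans (n<d^n d 1<d C) (^-monoʳ-≤ d C≤m)

-- With R(a + p·k) ⊆ R(a) for a DFA recognising L, condition (2) with
-- r = a + |τ| and s = p gives a word ρτ ∈ L with |ρ| = a + p·k; a word ρ' of
-- length a reaching the same state as ρ then gives ρ'τ ∈ L.
periodic⇒completable : ∀ {d A} (M : DFA d) →
  (∀ w → (DFA.accepts M w ≡ true) ⇔ A (evalℕ d w)) → Cond2 d A →
  ∀ {a p} → 1 ≤ p →
  (∀ k q → Reachability.Reachable M (a + p * k) q → Reachability.Reachable M a q) →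
  Completable d A a
periodic⇒completable {d} {A} M M-recognises c2 {a} {p} 1≤p periodic τ
  with c2 (a + length τ) p 1≤p τ
... | k , .(ρ ++ τ) , Aρτ , len , ρ , refl =
  let ρ' , len' , same = periodic k (DFA.run M (DFA.start M) ρ) (ρ , prefix-length , refl)
  in ρ' , len' ,
     Equivalence.to (M-recognises (ρ' ++ τ))
       (trans (Reachability.accepts-prefix M ρ' ρ τ same)
              (Equivalence.from (M-recognises (ρ ++ τ)) Aρτ))
  where
  swap : ∀ x y z → x + y + z ≡ x + z + y
  swap = solve-∀
  prefix-length : length ρ ≡ a + p * k
  prefix-length = +-cancelʳ-≡ (length τ) (length ρ) (a + p * k)
    (trans (sym (length-++ ρ)) (trans len (swap a (length τ) (p * k))))

cond2⇒completable : ∀ d {A} → Regular d (λ w → A (evalℕ d w)) → Cond2 d A →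
  ∃[ a ] Completable d A a
cond2⇒completable d {A} (M , M-recognises) c2 =
  let a , p , 1≤p , periodic = Reachability.eventuallyPeriodic M
  in a , periodic⇒completable {A = A} M M-recognises c2 1≤p periodic

inBlock : ∀ {x D} t → x < D → D * t ≤ x + D * t × x + D * t < D * t + D
inBlock {x} {D} t x<D =
  m≤n+m (D * t) x , subst (x + D * t <_) (+-comm D (D * t)) (+-monoˡ-< (D * t) x<D)

-- If A is a-completable, every block [D·t, D·t + D), D = d^a, meets A:
-- complete the numeral of t by a prefix of a digits.
completable⇒blocks : ∀ d .{{_ : NonZero d}} → 1 < d → ∀ {A a} → Completable d A a →
  ∀ t → ∃[ m ] (A m × d ^ a * t ≤ m × m < d ^ a * t + d ^ a)
completable⇒blocks d 1<d {A} {a} completable t =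
  let τ , _ , τ-val = numeral d t t (n<d^n d 1<d t)
      ρ , len , Aρτ = completable τ
      ρ<d^a = subst (λ l → evalℕ d ρ < d ^ l) len (evalℕ-< d ρ)
      value = trans (evalℕ-prefix d ρ τ len refl)
                    (cong (λ v → evalℕ d ρ + d ^ a * v) τ-val)
  in evalℕ d (ρ ++ τ) , Aρτ ,
     subst (λ v → d ^ a * t ≤ v × v < d ^ a * t + d ^ a) (sym value) (inBlock t ρ<d^a)

-- If every block [D·t, D·t + D) meets A, the gaps are at most 2D: the block
-- starting at D·(⌊n/D⌋ + 1) lies in [n, n + 2D].
blocks⇒boundedGaps : ∀ {A} D .{{_ : NonZero D}} →
  (∀ t → ∃[ m ] (A m × D * t ≤ m × m < D * t + D)) → BoundedGaps A (D + D)
blocks⇒boundedGaps D blocks n =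
  let m , Am , start≤m , m<end = blocks (suc (n / D))
  in m , Am , ≤-trans n≤start start≤m , ≤-trans (<⇒≤ m<end) end≤n+2D
  where
  open ≤-Reasoning
  Dq≤n : D * (n / D) ≤ n
  Dq≤n = subst (_≤ n) (*-comm (n / D) D) (m/n*n≤m n D)
  n≤start : n ≤ D * suc (n / D)
  n≤start = <⇒≤ (begin-strict
    n                    ≡⟨ m≡m%n+[m/n]*n n D ⟩
    n % D + n / D * D    <⟨ +-monoˡ-< (n / D * D) (m%n<n n D) ⟩
    D + n / D * D        ≡⟨ cong (λ y → D + y) (*-comm (n / D) D) ⟩
    D + D * (n / D)      ≡⟨ sym (*-suc D (n / D)) ⟩
    D * suc (n / D)      ∎)
  end≤n+2D : D * suc (n / D) + D ≤ n + (D + D)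
  end≤n+2D = begin
    D * suc (n / D) + D  ≡⟨ cong (_+ D) (*-suc D (n / D)) ⟩
    D + D * (n / D) + D  ≤⟨ +-monoˡ-≤ D (+-monoʳ-≤ D Dq≤n) ⟩
    D + n + D            ≡⟨ rearrange D n ⟩
    n + (D + D)          ∎
    where
    rearrange : ∀ x y → x + y + x ≡ y + (x + x)
    rearrange = solve-∀

lemma4p5 : (d : ℕ) → 2 ≤ d → (A : ℕ → Set) → AutomaticℤSet d (asℤSet A) →
    Generic A ⇔ Cond2 d A
lemma4p5 zero      () A automatic
lemma4p5 d@(suc _) 1<d A automatic = mk⇔ generic⇒cond2 cond2⇒generic
  where
  generic⇒cond2 : Generic A → Cond2 d A
  generic⇒cond2 generic =
    let C , gaps = generic⇒boundedGaps generic in boundedGaps⇒cond2 d 1<d gaps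
  cond2⇒generic : Cond2 d A → Generic A
  cond2⇒generic c2 =
    let a , completable = cond2⇒completable d {A} (digitLanguageRegular d A automatic) c2
    in boundedGaps⇒generic
         (blocks⇒boundedGaps (d ^ a) {{m^n≢0 d a}} (completable⇒blocks d 1<d {A} completable))
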